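{- There exists a cyclic $(45;18,10;9)$ difference family, i.e. there exist subsets $X_1,X_2\subseteq \mathbb{Z}_{45}$ with $|X_1|=18$, $|X_2|=10$ such that for every nonzero $a\in\mathbb{Z}_{45}$, $$\#\{(x,y)\in X_1\times X_1: y-x=a\}+\#\{(x,y)\in X_2\times X_2: y-x=a\}=9.$$
   Context: $\mathbb{Z}_v$ denotes the cyclic group (ring) of integers modulo $v$. A cyclic $(v;r,s;\lambda)$ difference family (a pair of supplementary difference sets) is a pair $(X_1,X_2)$ of subsets of $\mathbb{Z}_v$ with $|X_1|=r$, $|X_2|=s$ such that for every nonzero $a\in\mathbb{Z}_v$ the total number of ordered pairs $(x,y)$ with $x,y$ in the same block $X_i$ and $y-x=a$ equals $\lambda$. -}

module Defs where

open import Data.Nat using (ℕ; suc; _+_; _∸_)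
open import Data.Nat.DivMod using (_mod_)
open import Data.Fin using (Fin; toℕ)
open import Data.Fin.Subset using (Subset; _∈_; ∣_∣)
open import Data.Fin.Subset.Properties using (_∈?_)
open import Data.List using (List; length; filter; cartesianProduct)
open import Data.List using (allFin)
open import Data.Product using (_×_; _,_; proj₁; proj₂)
open import Relation.Nullary.Decidable using (_×-dec_)
open import Data.Fin.Properties using (_≟_)
open import Relation.Binary.PropositionalEquality using (_≡_)
open import Relation.Nullary using (¬_)

_⊖_ : ∀ {n} → Fin (suc n) → Fin (suc n) → Fin (suc n)
_⊖_ {n} y x = (toℕ y + (suc n ∸ toℕ x)) mod (suc n)

diffCount : ∀ {n} → Subset (suc n) → Fin (suc n) → ℕ
diffCount {n} X a =
  length (filter (λ p → ((proj₁ p ∈? X) ×-dec (proj₂ p ∈? X)) ×-dec ((proj₂ p ⊖ proj₁ p) ≟ a))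
                 (cartesianProduct (allFin (suc n)) (allFin (suc n))))

-- A cyclic (v ; r , s ; λ) difference family (pair of supplementary difference sets),
-- for v = suc n.
IsDifferenceFamily₂ : (n r s λ' : ℕ) → Subset (suc n) → Subset (suc n) → Set
IsDifferenceFamily₂ n r s λ' X₁ X₂ =
  (∣ X₁ ∣ ≡ r) × (∣ X₂ ∣ ≡ s) ×
  (∀ (a : Fin (suc n)) → ¬ (a ≡ Fin.zero) → diffCount X₁ a + diffCount X₂ a ≡ λ')

module Submission where

open import Defs
open import Data.Fin using (zero; toℕ)
open import Data.Fin.Properties using (all?; _≟_)
open import Data.Fin.Subset using (Subset)
open import Data.Bool.ListAction using (any)
open import Data.List using (List; []; _∷_)
open import Data.Nat using (ℕ; _+_; _≡ᵇ_)
import Data.Nat.Properties as ℕ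
open import Data.Product using (Σ; _,_)
open import Data.Vec using (tabulate)
open import Relation.Binary.PropositionalEquality using (_≡_; refl)
open import Relation.Nullary using (¬_; ¬?)
open import Relation.Nullary.Decidable using (from-yes; _→-dec_)

-- Entries ≥ n are ignored; the cardinalities 18 and 10 are then checked by refl.
fromList : ∀ {n} → List ℕ → Subset n
fromList xs = tabulate λ i → any (toℕ i ≡ᵇ_) xs

X₁ X₂ : Subset 45
X₁ = fromList (3 ∷ 4 ∷ 5 ∷ 8 ∷ 9 ∷ 12 ∷ 14 ∷ 22 ∷ 25 ∷ 27 ∷ 28 ∷ 29 ∷ 36 ∷ 37 ∷ 39 ∷ 41 ∷ 43 ∷ 44 ∷ [])
X₂ = fromList (2 ∷ 5 ∷ 6 ∷ 7 ∷ 14 ∷ 18 ∷ 24 ∷ 26 ∷ 41 ∷ 44 ∷ [])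

supplementary : ∀ a → ¬ a ≡ zero → diffCount X₁ a + diffCount X₂ a ≡ 9
supplementary = from-yes (all? λ a → ¬? (a ≟ zero) →-dec (diffCount X₁ a + diffCount X₂ a ℕ.≟ 9))

mainTheorem1 : Σ (Subset 45) (λ X₁ → Σ (Subset 45) (λ X₂ → IsDifferenceFamily₂ 44 18 10 9 X₁ X₂))
mainTheorem1 = X₁ , X₂ , refl , refl , supplementary
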